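{- Let $p$ be an odd prime, $\mathbf{S}(p)=(s^{(p)}_i)_{i\ge0}$ the $p$-Singer sequence, and $\Xi_p(t)=\sum_{i\ge0}s^{(p)}_it^{ -i}\in\mathbb{F}_p((t^{ -1}))$. Then $\Xi_p(t)=(1+t^{ -2})^{1/2}$.
   Context: $\mathbb{F}_p((t^{ -1}))$ is the field of formal Laurent series in $t^{ -1}$ over $\mathbb{F}_p$; $(1+t^{ -2})^{1/2}$ denotes the power series in $t^{ -1}$ with constant term $1$ whose square is $1+t^{ -2}$. $p_2=(p-1)/2$; for real $a,b$, $\binom{a}{b}=\frac{a!}{b!(a-b)!}$ if $a,b$ are nonnegative integers with $a\ge b$, and $0$ otherwise. $p$-Singer: $\varphi_p$ sends each letter $n\in\{0,\dots,p-1\}$ (identified with $\mathbb{F}_p$) to the length-$p$ word with $i$-th letter $n\binom{p_2}{i}\bmod p$; $\tau_p$ sends $n$ to the length-$2p$ word with $i$-th letter $n\binom{p_2+1}{i/2}\bmod p$ ($0\le i\le 2p-1$); both extended to words by concatenation; $\mathbf{S}(p)=\tau_p(\lim_k\varphi_p^k(1))$. -}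

module Defs where

open import Data.Nat using (ℕ; zero; suc; _+_; _*_; _∸_; _^_; _%_; ⌊_/2⌋)
open import Data.Nat.Combinatorics using (_C_)
open import Data.Bool using (Bool; if_then_else_)
open import Data.List using (List; []; _∷_; map; concatMap; upTo)
open import Data.Nat.ListAction using (sum)
open import Function using (_∘_)

-- reduction modulo p (the letters / F_p are identified with {0,…,p-1});
-- for p = 0 we return n unchanged (never used: p is prime)
_mod_ : ℕ → ℕ → ℕ
n mod zero = n
n mod suc q = n % suc q

isEven : ℕ → Bool
isEven zero = Data.Bool.true
isEven (suc zero) = Data.Bool.false
isEven (suc (suc n)) = isEven n

p₂ : ℕ → ℕ
p₂ p = ⌊ p ∸ 1 /2⌋

φ : ℕ → List ℕ → List ℕ
φ p = concatMap (λ n → map (λ i → (n * (p₂ p C i)) mod p) (upTo p))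

-- τ_p : letter n ↦ word of length 2p, i-th letter n·C(p₂+1, i/2) mod p,
-- where the binomial is 0 when i/2 is not an integer (i odd)
τ : ℕ → List ℕ → List ℕ
τ p = concatMap (λ n → map (λ i → if isEven i then (n * (suc (p₂ p) C ⌊ i /2⌋)) mod p else 0)
                           (upTo (2 * p)))

φIter : ℕ → ℕ → List ℕ
φIter p zero = 1 ∷ []
φIter p (suc k) = φ p (φIter p k)

-- index into a list (default 0 out of range; never reached below)
nth : List ℕ → ℕ → ℕ
nth [] _ = 0
nth (x ∷ xs) zero = x
nth (x ∷ xs) (suc n) = nth xs n

-- The p-Singer sequence S(p) = τ_p(lim_k φ_p^k(1)):
-- since φ_p(1) begins with 1, φ_p^k(1) is a prefix of the fixed point, of length p^k;
-- τ_p(φ_p^(n+1)(1)) has length 2p·p^(n+1) > n, so its n-th letter is s_n.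
singer : ℕ → ℕ → ℕ
singer p n = nth (τ p (φIter p (suc n))) n

ΞsqCoeff : ℕ → ℕ → ℕ
ΞsqCoeff p n = sum (map (λ k → singer p k * singer p (n ∸ k)) (upTo (suc n))) mod p

onePlusX² : ℕ → ℕ
onePlusX² zero = 1
onePlusX² (suc (suc zero)) = 1
onePlusX² _ = 0

-- Identify a power series in x = t⁻¹ with its coefficient sequence and let
-- p = 2h + 1.  The fixed point u of φ_p satisfies u(x) = (1 + x)ʰ u(xᵖ), and
-- τ_p turns it into Ξ_p(x) = Y(x²) with Y(x) = (1 + x)ʰ⁺¹ u(xᵖ).  Modulo p,
-- put W = u² and V = (1 + x) W: Frobenius (1 + x)ᵖ ≡ 1 + xᵖ gives
-- V(x) = (1 + x)ᵖ W(xᵖ) ≡ V(xᵖ), so V is the constant V(0) = 1.  Hence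
-- Y² = (1 + x) (1 + x)ᵖ W(xᵖ) ≡ (1 + x) V(xᵖ) ≡ 1 + x, and Ξ_p² ≡ 1 + x².
module Submission where

open import Data.Bool using (if_then_else_)
open import Data.Empty using (⊥-elim)
open import Data.List using (List; []; _∷_; _++_; map; concatMap; upTo; applyUpTo; length)
open import Data.List.Properties using (length-++; length-map; length-applyUpTo; map-applyUpTo)
open import Data.Nat
open import Data.Nat.Combinatorics using (_C_; nCk≡n!/k![n-k]!; k![n∸k]!∣n!; k>n⇒nCk≡0; nCn≡1; nCk+nC[k+1]≡[n+1]C[k+1])
open import Data.Nat.Divisibility using (_∣_; divides; ∣⇒≤; m∣m*n; n∣m⇒m%n≡0)
open import Data.Nat.DivMod hiding (_mod_)
open import Data.Nat.Induction using (<-rec)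
open import Data.Nat.ListAction using (sum)
open import Data.Nat.Tactic.RingSolver using (solve-∀)
open import Data.Nat.Primality using (Prime; euclidsLemma; prime⇒nonTrivial)
open import Data.Nat.Properties
open import Algebra.Properties.CommutativeSemigroup +-commutativeSemigroup using (interchange; x∙yz≈y∙xz)
open import Data.Product using (_×_; _,_; Σ)
open import Data.Sum using (inj₁; inj₂)
open import Relation.Binary.Bundles using (Setoid)
open import Relation.Binary.Structures using (IsEquivalence)
open import Relation.Binary.PropositionalEquality
open import Relation.Nullary using (¬_)
import Relation.Binary.Reasoning.Setoid as SetoidReasoning

open import Defs

Series : Set
Series = ℕ → ℕ

∑ : ℕ → Series → ℕ
∑ zero    f = 0
∑ (suc n) f = f 0 + ∑ n (λ j → f (suc j))

∑-cong : ∀ n {f g : Series} → (∀ j → j < n → f j ≡ g j) → ∑ n f ≡ ∑ n g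
∑-cong zero    e = refl
∑-cong (suc n) e = cong₂ _+_ (e 0 z<s) (∑-cong n (λ j j<n → e (suc j) (s<s j<n)))

∑-zeros : ∀ n {f : Series} → (∀ j → j < n → f j ≡ 0) → ∑ n f ≡ 0
∑-zeros zero    e = refl
∑-zeros (suc n) e = cong₂ _+_ (e 0 z<s) (∑-zeros n (λ j j<n → e (suc j) (s<s j<n)))

∑-split : ∀ a b f → ∑ (a + b) f ≡ ∑ a f + ∑ b (λ r → f (a + r))
∑-split zero    b f = refl
∑-split (suc a) b f =
  trans (cong (f 0 +_) (∑-split a b (λ j → f (suc j)))) (sym (+-assoc (f 0) _ _))

∑-snoc : ∀ n f → ∑ (suc n) f ≡ ∑ n f + f n
∑-snoc zero    f = +-comm (f 0) 0
∑-snoc (suc n) f =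
  trans (cong (f 0 +_) (∑-snoc n (λ j → f (suc j)))) (sym (+-assoc (f 0) _ _))

∑-distrib-+ : ∀ n f g → ∑ n (λ j → f j + g j) ≡ ∑ n f + ∑ n g
∑-distrib-+ zero    f g = refl
∑-distrib-+ (suc n) f g =
  trans (cong (f 0 + g 0 +_) (∑-distrib-+ n _ _)) (interchange (f 0) (g 0) _ _)

∑-*ˡ : ∀ n c f → ∑ n (λ j → c * f j) ≡ c * ∑ n f
∑-*ˡ zero    c f = sym (*-zeroʳ c)
∑-*ˡ (suc n) c f =
  trans (cong (c * f 0 +_) (∑-*ˡ n c (λ j → f (suc j)))) (sym (*-distribˡ-+ c (f 0) _))

∑-*ʳ : ∀ n c f → ∑ n (λ j → f j * c) ≡ ∑ n f * c
∑-*ʳ n c f = trans (∑-cong n (λ j _ → *-comm (f j) c)) (trans (∑-*ˡ n c f) (*-comm c _))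

∑-reverse : ∀ n f → ∑ n f ≡ ∑ n (λ j → f (n ∸ suc j))
∑-reverse zero    f = refl
∑-reverse (suc n) f = begin
  ∑ (suc n) f                      ≡⟨ ∑-snoc n f ⟩
  ∑ n f + f n                      ≡⟨ +-comm (∑ n f) (f n) ⟩
  f n + ∑ n f                      ≡⟨ cong (f n +_) (∑-reverse n f) ⟩
  f n + ∑ n (λ j → f (n ∸ suc j))  ∎
  where open ≡-Reasoning

∑-triangle : ∀ N (F : ℕ → ℕ → ℕ) →
  ∑ N (λ j → ∑ (suc j) (λ a → F a j)) ≡ ∑ N (λ a → ∑ (N ∸ a) (λ c → F a (a + c)))
∑-triangle zero    F = refl
∑-triangle (suc N) F = begin
  ∑ (suc N) (λ j → ∑ (suc j) (λ a → F a j))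
    ≡⟨ ∑-snoc N _ ⟩
  ∑ N (λ j → ∑ (suc j) (λ a → F a j)) + ∑ (suc N) (λ a → F a N)
    ≡⟨ cong (_+ ∑ (suc N) (λ a → F a N)) (∑-triangle N F) ⟩
  ∑ N (λ a → ∑ (N ∸ a) (λ c → F a (a + c))) + ∑ (suc N) (λ a → F a N)
    ≡⟨ cong (_+ ∑ (suc N) (λ a → F a N)) (sym lastRow) ⟩
  ∑ (suc N) (λ a → ∑ (N ∸ a) (λ c → F a (a + c))) + ∑ (suc N) (λ a → F a N)
    ≡⟨ sym (∑-distrib-+ (suc N) row (λ a → F a N)) ⟩
  ∑ (suc N) (λ a → ∑ (N ∸ a) (λ c → F a (a + c)) + F a N)
    ≡⟨ ∑-cong (suc N) extendRow ⟩
  ∑ (suc N) (λ a → ∑ (suc N ∸ a) (λ c → F a (a + c))) ∎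
  where
  open ≡-Reasoning
  row : Series
  row a = ∑ (N ∸ a) (λ c → F a (a + c))
  lastRow : ∑ (suc N) (λ a → ∑ (N ∸ a) (λ c → F a (a + c)))
          ≡ ∑ N (λ a → ∑ (N ∸ a) (λ c → F a (a + c)))
  lastRow = trans (∑-snoc N row)
    (trans (cong (λ m → ∑ N row + ∑ m (λ c → F N (N + c))) (n∸n≡0 N)) (+-identityʳ (∑ N row)))
  extendRow : ∀ a → a < suc N →
    ∑ (N ∸ a) (λ c → F a (a + c)) + F a N ≡ ∑ (suc N ∸ a) (λ c → F a (a + c))
  extendRow a (s≤s a≤N) = begin
    ∑ (N ∸ a) (λ c → F a (a + c)) + F a N
      ≡⟨ cong (λ m → ∑ (N ∸ a) (λ c → F a (a + c)) + F a m) (sym (m+[n∸m]≡n a≤N)) ⟩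
    ∑ (N ∸ a) (λ c → F a (a + c)) + F a (a + (N ∸ a))
      ≡⟨ sym (∑-snoc (N ∸ a) _) ⟩
    ∑ (suc (N ∸ a)) (λ c → F a (a + c))
      ≡⟨ cong (λ m → ∑ m (λ c → F a (a + c))) (sym (+-∸-assoc 1 a≤N)) ⟩
    ∑ (suc N ∸ a) (λ c → F a (a + c)) ∎

infixl 7 _⊛_
_⊛_ : Series → Series → Series
(f ⊛ g) n = ∑ (suc n) (λ j → f j * g (n ∸ j))

⊛-congˡ : ∀ {f f′} g → f ≗ f′ → f ⊛ g ≗ f′ ⊛ g
⊛-congˡ g ef n = ∑-cong (suc n) (λ j _ → cong (_* g (n ∸ j)) (ef j))

⊛-congʳ : ∀ f {g g′} → g ≗ g′ → f ⊛ g ≗ f ⊛ g′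
⊛-congʳ f eg n = ∑-cong (suc n) (λ j _ → cong (f j *_) (eg (n ∸ j)))

⊛-comm : ∀ f g → f ⊛ g ≗ g ⊛ f
⊛-comm f g n = trans (∑-reverse (suc n) (λ j → f j * g (n ∸ j))) (∑-cong (suc n) reflect)
  where
  reflect : ∀ j → j < suc n → f (n ∸ j) * g (n ∸ (n ∸ j)) ≡ g j * f (n ∸ j)
  reflect j (s≤s j≤n) =
    trans (cong (λ m → f (n ∸ j) * g m) (m∸[m∸n]≡n j≤n)) (*-comm (f (n ∸ j)) (g j))

⊛-assoc : ∀ f g h → (f ⊛ g) ⊛ h ≗ f ⊛ (g ⊛ h)
⊛-assoc f g h n = begin
  ∑ (suc n) (λ j → ∑ (suc j) (λ a → f a * g (j ∸ a)) * h (n ∸ j))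
    ≡⟨ ∑-cong (suc n) (λ j _ → sym (∑-*ʳ (suc j) (h (n ∸ j)) (λ a → f a * g (j ∸ a)))) ⟩
  ∑ (suc n) (λ j → ∑ (suc j) (λ a → f a * g (j ∸ a) * h (n ∸ j)))
    ≡⟨ ∑-triangle (suc n) (λ a j → f a * g (j ∸ a) * h (n ∸ j)) ⟩
  ∑ (suc n) (λ a → ∑ (suc n ∸ a) (λ c → f a * g (a + c ∸ a) * h (n ∸ (a + c))))
    ≡⟨ ∑-cong (suc n) inner ⟩
  ∑ (suc n) (λ a → f a * ∑ (suc (n ∸ a)) (λ c → g c * h (n ∸ a ∸ c))) ∎
  where
  open ≡-Reasoning
  inner : ∀ a → a < suc n →
    ∑ (suc n ∸ a) (λ c → f a * g (a + c ∸ a) * h (n ∸ (a + c)))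
      ≡ f a * ∑ (suc (n ∸ a)) (λ c → g c * h (n ∸ a ∸ c))
  inner a (s≤s a≤n) = begin
    ∑ (suc n ∸ a) (λ c → f a * g (a + c ∸ a) * h (n ∸ (a + c)))
      ≡⟨ cong (λ m → ∑ m (λ c → f a * g (a + c ∸ a) * h (n ∸ (a + c)))) (+-∸-assoc 1 a≤n) ⟩
    ∑ (suc (n ∸ a)) (λ c → f a * g (a + c ∸ a) * h (n ∸ (a + c)))
      ≡⟨ ∑-cong (suc (n ∸ a)) (λ c _ →
           trans (cong₂ (λ u v → f a * g u * h v) (m+n∸m≡n a c) (sym (∸-+-assoc n a c)))
                 (*-assoc (f a) _ _)) ⟩
    ∑ (suc (n ∸ a)) (λ c → f a * (g c * h (n ∸ a ∸ c)))
      ≡⟨ ∑-*ˡ (suc (n ∸ a)) (f a) (λ c → g c * h (n ∸ a ∸ c)) ⟩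
    f a * ∑ (suc (n ∸ a)) (λ c → g c * h (n ∸ a ∸ c)) ∎

⊛-interchange : ∀ a b c d → (a ⊛ b) ⊛ (c ⊛ d) ≗ (a ⊛ c) ⊛ (b ⊛ d)
⊛-interchange a b c d n = begin
  ((a ⊛ b) ⊛ (c ⊛ d)) n  ≡⟨ ⊛-assoc a b (c ⊛ d) n ⟩
  (a ⊛ (b ⊛ (c ⊛ d))) n  ≡⟨ ⊛-congʳ a (λ m → sym (⊛-assoc b c d m)) n ⟩
  (a ⊛ ((b ⊛ c) ⊛ d)) n  ≡⟨ ⊛-congʳ a (⊛-congˡ d (⊛-comm b c)) n ⟩
  (a ⊛ ((c ⊛ b) ⊛ d)) n  ≡⟨ ⊛-congʳ a (⊛-assoc c b d) n ⟩
  (a ⊛ (c ⊛ (b ⊛ d))) n  ≡⟨ sym (⊛-assoc a c (b ⊛ d) n) ⟩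
  ((a ⊛ c) ⊛ (b ⊛ d)) n  ∎
  where open ≡-Reasoning

const : ℕ → Series
const c zero    = c
const c (suc _) = 0

const-positive : ∀ {c n} → 0 < n → const c n ≡ 0
const-positive {n = suc _} _ = refl

⊛-identityˡ : ∀ f → const 1 ⊛ f ≗ f
⊛-identityˡ f n =
  trans (cong (1 * f n +_) (∑-zeros n (λ _ _ → refl)))
        (trans (+-identityʳ (1 * f n)) (*-identityˡ (f n)))

⊛-identityʳ : ∀ f → f ⊛ const 1 ≗ f
⊛-identityʳ f n = trans (⊛-comm f (const 1) n) (⊛-identityˡ f n)

-- dilate k f is the series f(xᵏ)
dilate : (k : ℕ) .{{_ : NonZero k}} → Series → Series
dilate k f n = const (f (n / k)) (n % k)

module _ (k : ℕ) .{{_ : NonZero k}} where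

  1+m*k>0 : ∀ m → 0 < suc m * k
  1+m*k>0 m = ≤-trans (>-nonZero⁻¹ k) (m≤m+n k (m * k))

  quotRem-elim : (P : ℕ → Set) → (∀ i m → i < k → P (i + m * k)) → ∀ n → P n
  quotRem-elim P f n = subst P (sym (m≡m%n+[m/n]*n n k)) (f (n % k) (n / k) (m%n<n n k))

  [i+m*k]/k≡m : ∀ i m → i < k → (i + m * k) / k ≡ m
  [i+m*k]/k≡m i m i<k = begin
    (i + m * k) / k     ≡⟨ +-distrib-/ i (m * k) remainders<k ⟩
    i / k + m * k / k   ≡⟨ cong₂ _+_ (m<n⇒m/n≡0 i<k) (m*n/n≡m m k) ⟩
    m                   ∎
    where
    open ≡-Reasoning
    remainders<k : i % k + (m * k) % k < k
    remainders<k = subst (_< k)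
      (sym (trans (cong₂ _+_ (m<n⇒m%n≡m i<k) (m*n%n≡0 m k)) (+-identityʳ i))) i<k

  dilate-eval : ∀ f i m → i < k → dilate k f (i + m * k) ≡ const (f m) i
  dilate-eval f i m i<k = cong₂ (λ r q → const (f q) r)
    (trans ([m+kn]%n≡m%n i m k) (m<n⇒m%n≡m i<k)) ([i+m*k]/k≡m i m i<k)

  dilate-const : ∀ c → dilate k (const c) ≗ const c
  dilate-const c = quotRem-elim (λ n → dilate k (const c) n ≡ const c n)
    (λ i m i<k → trans (dilate-eval (const c) i m i<k) (spread i m))
    where
    spread : ∀ i m → const (const c m) i ≡ const c (i + m * k)
    spread zero    zero    = refl
    spread zero    (suc m) = sym (const-positive (1+m*k>0 m))
    spread (suc i) m       = refl

  ∑-dilate-block : ∀ f (g : Series) m b → 0 < b → b ≤ k →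
    ∑ b (λ r → dilate k f (m * k + r) * g (m * k + r)) ≡ f m * g (m * k)
  ∑-dilate-block f g m (suc b) _ b≤k = begin
    dilate k f (m * k + 0) * g (m * k + 0) + ∑ b (λ r → dilate k f (m * k + suc r) * g (m * k + suc r))
      ≡⟨ cong₂ _+_ head (∑-zeros b tail) ⟩
    f m * g (m * k) + 0
      ≡⟨ +-identityʳ _ ⟩
    f m * g (m * k) ∎
    where
    open ≡-Reasoning
    head : dilate k f (m * k + 0) * g (m * k + 0) ≡ f m * g (m * k)
    head = begin
      dilate k f (m * k + 0) * g (m * k + 0)
        ≡⟨ cong (λ n → dilate k f n * g n) (+-identityʳ (m * k)) ⟩
      dilate k f (0 + m * k) * g (m * k)
        ≡⟨ cong (_* g (m * k)) (dilate-eval f 0 m (≤-trans (s≤s z≤n) b≤k)) ⟩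
      f m * g (m * k) ∎
    tail : ∀ r → r < b → dilate k f (m * k + suc r) * g (m * k + suc r) ≡ 0
    tail r r<b = begin
      dilate k f (m * k + suc r) * g (m * k + suc r)
        ≡⟨ cong (λ n → dilate k f n * g (m * k + suc r)) (+-comm (m * k) (suc r)) ⟩
      dilate k f (suc r + m * k) * g (m * k + suc r)
        ≡⟨ cong (_* g (m * k + suc r)) (dilate-eval f (suc r) m (≤-trans (s≤s r<b) b≤k)) ⟩
      0 ∎

  ∑-dilate : ∀ f (g : Series) m →
    ∑ (m * k) (λ j → dilate k f j * g j) ≡ ∑ m (λ l → f l * g (l * k))
  ∑-dilate f g zero    = refl
  ∑-dilate f g (suc m) = begin
    ∑ (k + m * k) (λ j → dilate k f j * g j)
      ≡⟨ cong (λ n → ∑ n (λ j → dilate k f j * g j)) (+-comm k (m * k)) ⟩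
    ∑ (m * k + k) (λ j → dilate k f j * g j)
      ≡⟨ ∑-split (m * k) k _ ⟩
    ∑ (m * k) (λ j → dilate k f j * g j) + ∑ k (λ r → dilate k f (m * k + r) * g (m * k + r))
      ≡⟨ cong₂ _+_ (∑-dilate f g m) (∑-dilate-block f g m k (>-nonZero⁻¹ k) ≤-refl) ⟩
    ∑ m (λ l → f l * g (l * k)) + f m * g (m * k)
      ≡⟨ sym (∑-snoc m _) ⟩
    ∑ (suc m) (λ l → f l * g (l * k)) ∎
    where open ≡-Reasoning

  dilate-⊛ˡ : ∀ f g i m → i < k →
    (dilate k f ⊛ g) (i + m * k) ≡ ∑ (suc m) (λ l → f l * g (i + (m ∸ l) * k))
  dilate-⊛ˡ f g i m i<k = begin
    ∑ (suc (i + m * k)) (λ j → dilate k f j * G j)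
      ≡⟨ cong (λ n → ∑ n (λ j → dilate k f j * G j)) (+-comm (suc i) (m * k)) ⟩
    ∑ (m * k + suc i) (λ j → dilate k f j * G j)
      ≡⟨ ∑-split (m * k) (suc i) _ ⟩
    ∑ (m * k) (λ j → dilate k f j * G j) + ∑ (suc i) (λ r → dilate k f (m * k + r) * G (m * k + r))
      ≡⟨ cong₂ _+_ (∑-dilate f G m) (∑-dilate-block f G m (suc i) z<s i<k) ⟩
    ∑ m (λ l → f l * G (l * k)) + f m * G (m * k)
      ≡⟨ sym (∑-snoc m _) ⟩
    ∑ (suc m) (λ l → f l * G (l * k))
      ≡⟨ ∑-cong (suc m) (λ l l≤m → cong (λ n → f l * g n) (shift l (≤-pred l≤m))) ⟩
    ∑ (suc m) (λ l → f l * g (i + (m ∸ l) * k)) ∎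
    where
    open ≡-Reasoning
    G : Series
    G j = g (i + m * k ∸ j)
    shift : ∀ l → l ≤ m → i + m * k ∸ l * k ≡ i + (m ∸ l) * k
    shift l l≤m = trans (+-∸-assoc i (*-monoˡ-≤ k l≤m)) (cong (i +_) (sym (*-distribʳ-∸ k m l)))

  dilate-⊛ : ∀ f g → dilate k f ⊛ dilate k g ≗ dilate k (f ⊛ g)
  dilate-⊛ f g = quotRem-elim (λ n → (dilate k f ⊛ dilate k g) n ≡ dilate k (f ⊛ g) n) block
    where
    block : ∀ i m → i < k → (dilate k f ⊛ dilate k g) (i + m * k) ≡ dilate k (f ⊛ g) (i + m * k)
    block i m i<k = begin
      (dilate k f ⊛ dilate k g) (i + m * k)
        ≡⟨ dilate-⊛ˡ f (dilate k g) i m i<k ⟩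
      ∑ (suc m) (λ l → f l * dilate k g (i + (m ∸ l) * k))
        ≡⟨ ∑-cong (suc m) (λ l _ → cong (f l *_) (dilate-eval g i (m ∸ l) i<k)) ⟩
      ∑ (suc m) (λ l → f l * const (g (m ∸ l)) i)
        ≡⟨ atOffset i ⟩
      const ((f ⊛ g) m) i
        ≡⟨ sym (dilate-eval (f ⊛ g) i m i<k) ⟩
      dilate k (f ⊛ g) (i + m * k) ∎
      where
      open ≡-Reasoning
      atOffset : ∀ i → ∑ (suc m) (λ l → f l * const (g (m ∸ l)) i) ≡ const ((f ⊛ g) m) i
      atOffset zero    = refl
      atOffset (suc i) = ∑-zeros (suc m) (λ l _ → *-zeroʳ (f l))

  ⊛-dilate-short : ∀ g f i m → i < k → (∀ j → k ≤ j → g j ≡ 0) →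
    (g ⊛ dilate k f) (i + m * k) ≡ g i * f m
  ⊛-dilate-short g f i m i<k short = begin
    (g ⊛ dilate k f) (i + m * k)
      ≡⟨ ⊛-comm g (dilate k f) _ ⟩
    (dilate k f ⊛ g) (i + m * k)
      ≡⟨ dilate-⊛ˡ f g i m i<k ⟩
    ∑ (suc m) (λ l → f l * g (i + (m ∸ l) * k))
      ≡⟨ ∑-snoc m _ ⟩
    ∑ m (λ l → f l * g (i + (m ∸ l) * k)) + f m * g (i + (m ∸ m) * k)
      ≡⟨ cong₂ _+_ (∑-zeros m earlier) (cong (λ d → f m * g (i + d * k)) (n∸n≡0 m)) ⟩
    f m * g (i + 0)
      ≡⟨ cong (λ j → f m * g j) (+-identityʳ i) ⟩
    f m * g i
      ≡⟨ *-comm (f m) (g i) ⟩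
    g i * f m ∎
    where
    open ≡-Reasoning
    beyond : ∀ d → d ≢ 0 → k ≤ i + d * k
    beyond zero    d≢0 = ⊥-elim (d≢0 refl)
    beyond (suc d) _   = ≤-trans (m≤m+n k (d * k)) (m≤n+m (k + d * k) i)
    earlier : ∀ l → l < m → f l * g (i + (m ∸ l) * k) ≡ 0
    earlier l l<m =
      trans (cong (f l *_) (short _ (beyond (m ∸ l) (m>n⇒m∸n≢0 l<m)))) (*-zeroʳ (f l))

binom : ℕ → Series
binom m j = m C j

binom-zero : binom 0 ≗ const 1
binom-zero zero    = refl
binom-zero (suc j) = refl

binom-suc : ∀ m → binom 1 ⊛ binom m ≗ binom (suc m)
binom-suc m zero    = refl
binom-suc m (suc n) = begin
  1 * (m C suc n) + (1 * (m C n) + ∑ n (λ _ → 0))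
    ≡⟨ cong (λ s → 1 * (m C suc n) + (1 * (m C n) + s)) (∑-zeros n (λ _ _ → refl)) ⟩
  1 * (m C suc n) + (1 * (m C n) + 0)
    ≡⟨ cong₂ _+_ (*-identityˡ (m C suc n)) (trans (+-identityʳ (1 * (m C n))) (*-identityˡ (m C n))) ⟩
  m C suc n + m C n
    ≡⟨ +-comm (m C suc n) (m C n) ⟩
  m C n + m C suc n
    ≡⟨ nCk+nC[k+1]≡[n+1]C[k+1] m n ⟩
  suc m C suc n ∎
  where open ≡-Reasoning

binom-+ : ∀ a b → binom a ⊛ binom b ≗ binom (a + b)
binom-+ zero    b n = trans (⊛-congˡ (binom b) binom-zero n) (⊛-identityˡ (binom b) n)
binom-+ (suc a) b n = begin
  (binom (suc a) ⊛ binom b) n       ≡⟨ ⊛-congˡ (binom b) (λ m → sym (binom-suc a m)) n ⟩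
  ((binom 1 ⊛ binom a) ⊛ binom b) n ≡⟨ ⊛-assoc (binom 1) (binom a) (binom b) n ⟩
  (binom 1 ⊛ (binom a ⊛ binom b)) n ≡⟨ ⊛-congʳ (binom 1) (binom-+ a b) n ⟩
  (binom 1 ⊛ binom (a + b)) n       ≡⟨ binom-suc (a + b) n ⟩
  binom (suc a + b) n               ∎
  where open ≡-Reasoning

module Congruence (p : ℕ) .{{_ : NonZero p}} where

  infix 4 _≈_
  record _≈_ (f g : Series) : Set where
    constructor mk≈
    field pointwise : ∀ n → f n % p ≡ g n % p
  open _≈_ public

  ≈-refl : ∀ {f} → f ≈ f
  ≈-refl = mk≈ λ _ → refl

  ≈-isEquivalence : IsEquivalence _≈_
  ≈-isEquivalence = record
    { refl  = ≈-refl
    ; sym   = λ e → mk≈ λ n → sym (pointwise e n)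
    ; trans = λ e e′ → mk≈ λ n → trans (pointwise e n) (pointwise e′ n)
    }

  ≈-setoid : Setoid _ _
  ≈-setoid = record { isEquivalence = ≈-isEquivalence }

  module ≈-Reasoning = SetoidReasoning ≈-setoid

  ≗⇒≈ : ∀ {f g} → f ≗ g → f ≈ g
  ≗⇒≈ e = mk≈ λ n → cong (_% p) (e n)

  %-cong-+ : ∀ {a a′ b b′} → a % p ≡ a′ % p → b % p ≡ b′ % p → (a + b) % p ≡ (a′ + b′) % p
  %-cong-+ {a} {a′} {b} {b′} ea eb = trans (%-distribˡ-+ a b p)
    (trans (cong₂ (λ x y → (x + y) % p) ea eb) (sym (%-distribˡ-+ a′ b′ p)))

  %-cong-* : ∀ {a a′ b b′} → a % p ≡ a′ % p → b % p ≡ b′ % p → (a * b) % p ≡ (a′ * b′) % p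
  %-cong-* {a} {a′} {b} {b′} ea eb = trans (%-distribˡ-* a b p)
    (trans (cong₂ (λ x y → (x * y) % p) ea eb) (sym (%-distribˡ-* a′ b′ p)))

  ∑-cong-% : ∀ n {f g : Series} → (∀ j → j < n → f j % p ≡ g j % p) → ∑ n f % p ≡ ∑ n g % p
  ∑-cong-% zero    e = refl
  ∑-cong-% (suc n) e = %-cong-+ (e 0 z<s) (∑-cong-% n (λ j j<n → e (suc j) (s<s j<n)))

  ⊛-cong-≈ : ∀ {f f′ g g′} → f ≈ f′ → g ≈ g′ → f ⊛ g ≈ f′ ⊛ g′
  ⊛-cong-≈ ef eg = mk≈ λ n →
    ∑-cong-% (suc n) (λ j _ → %-cong-* (pointwise ef j) (pointwise eg (n ∸ j)))

  ⊛-congˡ-≈ : ∀ {f f′} g → f ≈ f′ → f ⊛ g ≈ f′ ⊛ g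
  ⊛-congˡ-≈ g ef = ⊛-cong-≈ ef (≈-refl {g})

  ⊛-congʳ-≈ : ∀ f {g g′} → g ≈ g′ → f ⊛ g ≈ f ⊛ g′
  ⊛-congʳ-≈ f eg = ⊛-cong-≈ (≈-refl {f}) eg

  const-cong-≈ : ∀ {a b} → a % p ≡ b % p → const a ≈ const b
  const-cong-≈ e = mk≈ λ { zero → e ; (suc _) → refl }

  dilate-cong-≈ : ∀ k .{{_ : NonZero k}} {f g} → f ≈ g → dilate k f ≈ dilate k g
  dilate-cong-≈ k e = mk≈ λ n → pointwise (const-cong-≈ (pointwise e (n / k))) (n % k)

  -- Strong induction: the coefficient at n > 0 is the one at n / k < n,
  -- or 0 when k ∤ n.
  dilate-fixed⇒const : ∀ k .{{_ : NonZero k}} {V} → 1 < k → V ≈ dilate k V → V ≈ const (V 0)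
  dilate-fixed⇒const k {V} 1<k fixed = mk≈ (<-rec _ (quotRem-elim k _ digit))
    where
    P : ℕ → Set
    P n = V n % p ≡ const (V 0) n % p
    digit : ∀ i m → i < k → (∀ {n} → n < i + m * k → P n) → P (i + m * k)
    digit i m i<k ih = trans (pointwise fixed (i + m * k))
                             (trans (cong (_% p) (dilate-eval k V i m i<k)) (leading i m ih))
      where
      leading : ∀ i m → (∀ {n} → n < i + m * k → P n) → const (V m) i % p ≡ const (V 0) (i + m * k) % p
      leading zero    zero    _  = refl
      leading zero    (suc m) ih =
        trans (ih (m<m*n (suc m) k 1<k)) (cong (_% p) (sym (const-positive (1+m*k>0 k m))))
      leading (suc i) m       _  = refl

module Frobenius {p : ℕ} .{{_ : NonZero p}} (p-prime : Prime p) where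

  open Congruence p

  1<p : 1 < p
  1<p = nonTrivial⇒n>1 p {{prime⇒nonTrivial p-prime}}

  p∤m! : ∀ m → m < p → ¬ (p ∣ m !)
  p∤m! zero    _   p∣1 = <⇒≱ 1<p (∣⇒≤ p∣1)
  p∤m! (suc m) m<p p∣m! with euclidsLemma (suc m) (m !) p-prime p∣m!
  ... | inj₁ p∣sm = <⇒≱ m<p (∣⇒≤ p∣sm)
  ... | inj₂ p∣m! = p∤m! m (<-trans (n<1+n m) m<p) p∣m!

  p∣pCi : ∀ i → 0 < i → i < p → p ∣ p C i
  p∣pCi i 0<i i<p with euclidsLemma (p C i) (i ! * (p ∸ i) !) p-prime p∣p!
    where
    instance _ = i !* (p ∸ i) !≢0
    p∣p! : p ∣ (p C i) * (i ! * (p ∸ i) !)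
    p∣p! = subst (p ∣_) (sym (trans (cong (_* (i ! * (p ∸ i) !)) (nCk≡n!/k![n-k]! (<⇒≤ i<p)))
                                    (m/n*n≡m (k![n∸k]!∣n! (<⇒≤ i<p)))))
                 (n∣n! p)
      where
      n∣n! : ∀ n .{{_ : NonZero n}} → n ∣ n !
      n∣n! (suc n) = m∣m*n (n !)
  ... | inj₁ p∣pCi = p∣pCi
  ... | inj₂ p∣i!*[p∸i]! with euclidsLemma (i !) ((p ∸ i) !) p-prime p∣i!*[p∸i]!
  ...   | inj₁ p∣i!     = ⊥-elim (p∤m! i i<p p∣i!)
  ...   | inj₂ p∣[p∸i]! = ⊥-elim (p∤m! (p ∸ i) (∸-monoʳ-< 0<i (<⇒≤ i<p)) p∣[p∸i]!)

  binom-prime : binom p ≈ dilate p (binom 1)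
  binom-prime = mk≈ (quotRem-elim p _ λ i m i<p →
    trans (coefficient i m i<p) (cong (_% p) (sym (dilate-eval p (binom 1) i m i<p))))
    where
    beyond : ∀ i t → p < i + suc t * p → binom p (i + suc t * p) % p ≡ 0 % p
    beyond i t lt = cong (_% p) (k>n⇒nCk≡0 lt)
    coefficient : ∀ i m → i < p → binom p (i + m * p) % p ≡ const (binom 1 m) i % p
    coefficient zero    zero          _   = refl
    coefficient zero    (suc zero)    _   = cong (_% p) (trans (cong (p C_) (+-identityʳ p)) (nCn≡1 p))
    coefficient zero    (suc (suc t)) _   = beyond 0 (suc t) (m<m+n p (≤-trans (>-nonZero⁻¹ p) (m≤m+n p (t * p))))
    coefficient (suc i) zero          i<p =
      trans (cong (λ n → binom p n % p) (+-identityʳ (suc i)))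
            (trans (n∣m⇒m%n≡0 _ p (p∣pCi (suc i) z<s i<p)) (sym (m*n%n≡0 0 p)))
    coefficient (suc i) (suc t)       _   =
      beyond (suc i) t (s≤s (≤-trans (m≤m+n p (t * p)) (m≤n+m (p + t * p) i)))

  binom-prime-⊛-dilate : ∀ W → binom p ⊛ dilate p W ≈ dilate p (binom 1 ⊛ W)
  binom-prime-⊛-dilate W = begin
    binom p ⊛ dilate p W               ≈⟨ ⊛-congˡ-≈ (dilate p W) binom-prime ⟩
    dilate p (binom 1) ⊛ dilate p W    ≈⟨ ≗⇒≈ (dilate-⊛ p (binom 1) W) ⟩
    dilate p (binom 1 ⊛ W)             ∎
    where open ≈-Reasoning

module SquareRoot (h : ℕ) (p-prime : Prime (suc (2 * h))) where

  p : ℕ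
  p = suc (2 * h)

  open Congruence p
  open Frobenius p-prime

  h+h≡2h : h + h ≡ 2 * h
  h+h≡2h = cong (h +_) (sym (+-identityʳ h))

  module _ {U : Series} (U₀ : U 0 % p ≡ 1 % p) (U-fixed : U ≈ binom h ⊛ dilate p U) where

    W : Series
    W = U ⊛ U

    V : Series
    V = binom 1 ⊛ W

    W-fixed : W ≈ binom (h + h) ⊛ dilate p W
    W-fixed = begin
      U ⊛ U
        ≈⟨ ⊛-cong-≈ U-fixed U-fixed ⟩
      (binom h ⊛ dilate p U) ⊛ (binom h ⊛ dilate p U)
        ≈⟨ ≗⇒≈ (⊛-interchange (binom h) (dilate p U) (binom h) (dilate p U)) ⟩
      (binom h ⊛ binom h) ⊛ (dilate p U ⊛ dilate p U)
        ≈⟨ ≗⇒≈ (⊛-congˡ (dilate p U ⊛ dilate p U) (binom-+ h h)) ⟩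
      binom (h + h) ⊛ (dilate p U ⊛ dilate p U)
        ≈⟨ ≗⇒≈ (⊛-congʳ (binom (h + h)) (dilate-⊛ p U U)) ⟩
      binom (h + h) ⊛ dilate p W ∎
      where open ≈-Reasoning

    V-fixed : V ≈ dilate p V
    V-fixed = begin
      binom 1 ⊛ W
        ≈⟨ ⊛-congʳ-≈ (binom 1) W-fixed ⟩
      binom 1 ⊛ (binom (h + h) ⊛ dilate p W)
        ≈⟨ ≗⇒≈ (λ n → sym (⊛-assoc (binom 1) (binom (h + h)) (dilate p W) n)) ⟩
      (binom 1 ⊛ binom (h + h)) ⊛ dilate p W
        ≈⟨ ≗⇒≈ (⊛-congˡ (dilate p W) pascal-p) ⟩
      binom p ⊛ dilate p W
        ≈⟨ binom-prime-⊛-dilate W ⟩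
      dilate p V ∎
      where
      open ≈-Reasoning
      pascal-p : binom 1 ⊛ binom (h + h) ≗ binom p
      pascal-p n = trans (binom-suc (h + h) n) (cong (λ m → suc m C n) h+h≡2h)

    V≈1 : V ≈ const 1
    V≈1 = begin
      V            ≈⟨ dilate-fixed⇒const p 1<p V-fixed ⟩
      const (V 0)  ≈⟨ const-cong-≈ (trans (cong (_% p) V₀≡U₀²) (%-cong-* {U 0} {1} {U 0} {1} U₀ U₀)) ⟩
      const 1      ∎
      where
      open ≈-Reasoning
      V₀≡U₀² : V 0 ≡ U 0 * U 0
      V₀≡U₀² = trans (+-identityʳ (1 * (U 0 * U 0 + 0)))
                     (trans (*-identityˡ (U 0 * U 0 + 0)) (+-identityʳ (U 0 * U 0)))

    square-root : (binom (suc h) ⊛ dilate p U) ⊛ (binom (suc h) ⊛ dilate p U) ≈ binom 1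
    square-root = begin
      (binom (suc h) ⊛ dilate p U) ⊛ (binom (suc h) ⊛ dilate p U)
        ≈⟨ ≗⇒≈ (⊛-interchange (binom (suc h)) (dilate p U) (binom (suc h)) (dilate p U)) ⟩
      (binom (suc h) ⊛ binom (suc h)) ⊛ (dilate p U ⊛ dilate p U)
        ≈⟨ ≗⇒≈ (⊛-congʳ (binom (suc h) ⊛ binom (suc h)) (dilate-⊛ p U U)) ⟩
      (binom (suc h) ⊛ binom (suc h)) ⊛ dilate p W
        ≈⟨ ≗⇒≈ (⊛-congˡ (dilate p W) vandermonde-1+p) ⟩
      (binom 1 ⊛ binom p) ⊛ dilate p W
        ≈⟨ ≗⇒≈ (⊛-assoc (binom 1) (binom p) (dilate p W)) ⟩
      binom 1 ⊛ (binom p ⊛ dilate p W)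
        ≈⟨ ⊛-congʳ-≈ (binom 1) (binom-prime-⊛-dilate W) ⟩
      binom 1 ⊛ dilate p V
        ≈⟨ ⊛-congʳ-≈ (binom 1) (dilate-cong-≈ p V≈1) ⟩
      binom 1 ⊛ dilate p (const 1)
        ≈⟨ ≗⇒≈ (λ n → trans (⊛-congʳ (binom 1) (dilate-const p 1) n) (⊛-identityʳ (binom 1) n)) ⟩
      binom 1 ∎
      where
      open ≈-Reasoning
      vandermonde-1+p : binom (suc h) ⊛ binom (suc h) ≗ binom 1 ⊛ binom p
      vandermonde-1+p n = trans (binom-+ (suc h) (suc h) n)
        (trans (cong (λ m → suc m C n) (trans (+-suc h h) (cong suc h+h≡2h))) (sym (binom-suc p n)))

nth-++ˡ : ∀ xs {ys i} → i < length xs → nth (xs ++ ys) i ≡ nth xs i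
nth-++ˡ (x ∷ xs) {i = zero}  _          = refl
nth-++ˡ (x ∷ xs) {i = suc i} (s≤s i<n) = nth-++ˡ xs i<n

nth-++ʳ : ∀ xs {ys} i → nth (xs ++ ys) (length xs + i) ≡ nth ys i
nth-++ʳ []       i = refl
nth-++ʳ (x ∷ xs) i = nth-++ʳ xs i

nth-applyUpTo : ∀ (f : ℕ → ℕ) n {i} → i < n → nth (applyUpTo f n) i ≡ f i
nth-applyUpTo f (suc n) {zero}  _         = refl
nth-applyUpTo f (suc n) {suc i} (s≤s i<n) = nth-applyUpTo (λ j → f (suc j)) n i<n

nth-map-upTo : ∀ (g : ℕ → ℕ) n {i} → i < n → nth (map g (upTo n)) i ≡ g i
nth-map-upTo g n {i} i<n =
  trans (cong (λ xs → nth xs i) (map-applyUpTo (λ j → j) g n)) (nth-applyUpTo g n i<n)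

length-map-upTo : ∀ (g : ℕ → ℕ) n → length (map g (upTo n)) ≡ n
length-map-upTo g n = trans (length-map g (upTo n)) (length-applyUpTo (λ j → j) n)

sum-applyUpTo : ∀ (f : ℕ → ℕ) n → sum (applyUpTo f n) ≡ ∑ n f
sum-applyUpTo f zero    = refl
sum-applyUpTo f (suc n) = cong (f 0 +_) (sum-applyUpTo (λ j → f (suc j)) n)

sum-map-upTo : ∀ (g : ℕ → ℕ) n → sum (map g (upTo n)) ≡ ∑ n g
sum-map-upTo g n = trans (cong sum (map-applyUpTo (λ j → j) g n)) (sum-applyUpTo g n)

module _ {F : ℕ → List ℕ} {L : ℕ} (length-F : ∀ x → length (F x) ≡ L) where

  length-concatMap : ∀ xs → length (concatMap F xs) ≡ length xs * L
  length-concatMap []       = refl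
  length-concatMap (x ∷ xs) =
    trans (length-++ (F x)) (cong₂ _+_ (length-F x) (length-concatMap xs))

  nth-concatMap : ∀ xs {m r} → m < length xs → r < L →
    nth (concatMap F xs) (r + m * L) ≡ nth (F (nth xs m)) r
  nth-concatMap (x ∷ xs) {zero}  {r} _ r<L =
    trans (cong (nth (F x ++ concatMap F xs)) (+-identityʳ r))
          (nth-++ˡ (F x) (subst (r <_) (sym (length-F x)) r<L))
  nth-concatMap (x ∷ xs) {suc m} {r} (s≤s m<n) r<L = begin
    nth (F x ++ concatMap F xs) (r + (L + m * L))
      ≡⟨ cong (nth (F x ++ concatMap F xs)) (x∙yz≈y∙xz r L (m * L)) ⟩
    nth (F x ++ concatMap F xs) (L + (r + m * L))
      ≡⟨ cong (λ l → nth (F x ++ concatMap F xs) (l + (r + m * L))) (sym (length-F x)) ⟩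
    nth (F x ++ concatMap F xs) (length (F x) + (r + m * L))
      ≡⟨ nth-++ʳ (F x) (r + m * L) ⟩
    nth (concatMap F xs) (r + m * L)
      ≡⟨ nth-concatMap xs m<n r<L ⟩
    nth (F (nth xs m)) r ∎
    where open ≡-Reasoning

m+[2+n]≡2+[m+n] : ∀ m n → m + suc (suc n) ≡ suc (suc (m + n))
m+[2+n]≡2+[m+n] m n = trans (+-suc m (suc n)) (cong suc (+-suc m n))

isEven-+-*2 : ∀ b i → isEven (b + i * 2) ≡ isEven b
isEven-+-*2 b zero    = cong isEven (+-identityʳ b)
isEven-+-*2 b (suc i) = trans (cong isEven (m+[2+n]≡2+[m+n] b (i * 2))) (isEven-+-*2 b i)

⌊b+i*2/2⌋≡i : ∀ b i → b < 2 → ⌊ b + i * 2 /2⌋ ≡ i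
⌊b+i*2/2⌋≡i b zero    b<2 = trans (cong ⌊_/2⌋ (+-identityʳ b)) (⌊b/2⌋≡0 b<2)
  where
  ⌊b/2⌋≡0 : ∀ {b} → b < 2 → ⌊ b /2⌋ ≡ 0
  ⌊b/2⌋≡0 {zero}        _ = refl
  ⌊b/2⌋≡0 {suc zero}    _ = refl
  ⌊b/2⌋≡0 {suc (suc b)} (s≤s (s≤s ()))
⌊b+i*2/2⌋≡i b (suc i) b<2 =
  trans (cong ⌊_/2⌋ (m+[2+n]≡2+[m+n] b (i * 2))) (cong suc (⌊b+i*2/2⌋≡i b i b<2))

dilate-2-binom-1 : dilate 2 (binom 1) ≗ onePlusX²
dilate-2-binom-1 = quotRem-elim 2 _ λ b n b<2 → trans (dilate-eval 2 (binom 1) b n b<2) (spread b n b<2)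
  where
  spread : ∀ b n → b < 2 → const (binom 1 n) b ≡ onePlusX² (b + n * 2)
  spread zero          zero          _ = refl
  spread zero          (suc zero)    _ = refl
  spread zero          (suc (suc n)) _ = refl
  spread (suc zero)    zero          _ = refl
  spread (suc zero)    (suc n)       _ = refl
  spread (suc (suc b)) _             (s≤s (s≤s ()))

module SingerSequence (h′ : ℕ) (p-prime : Prime (suc (2 * suc h′))) where

  h : ℕ
  h = suc h′

  open SquareRoot h p-prime
  open Congruence p
  open Frobenius p-prime using (1<p)

  p₂p≡h : p₂ p ≡ h
  p₂p≡h = trans (cong ⌊_/2⌋ (sym h+h≡2h)) (sym (n≡⌊n+n/2⌋ h))

  quotient-bound : ∀ {i m q} → i + m * p < p * q → m < q
  quotient-bound {i} {m} {q} lt =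
    *-cancelʳ-< p m q (≤-<-trans (m≤n+m (m * p) i) (subst (i + m * p <_) (*-comm p q) lt))

  digits-bound : ∀ {i m q} → i < p → m < q → i + m * p < p * q
  digits-bound {i} {m} {q} i<p m<q =
    subst (i + m * p <_) (*-comm q p) (≤-trans (+-monoˡ-< (m * p) i<p) (*-monoˡ-≤ p m<q))

  h<p : h < p
  h<p = s≤s (m≤m+n h (h + 0))

  1+h<p : suc h < p
  1+h<p = s≤s (s≤s (m<m+n h′ z<s))

  binom-short : ∀ {m} → m < p → ∀ j → p ≤ j → binom m j ≡ 0
  binom-short m<p j p≤j = k>n⇒nCk≡0 (<-≤-trans m<p p≤j)

  n<p^[1+n] : ∀ n → n < p ^ suc n
  n<p^[1+n] zero    = m^n>0 p 1
  n<p^[1+n] (suc n) = ≤-<-trans (n<p^[1+n] n) (^-monoʳ-< p 1<p (n<1+n (suc n)))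

  φ-block : ℕ → List ℕ
  φ-block n = map (λ i → (n * (p₂ p C i)) mod p) (upTo p)

  letter : ℕ → ℕ → ℕ
  letter k n = nth (φIter p k) n

  length-φIter : ∀ k → length (φIter p k) ≡ p ^ k
  length-φIter zero    = refl
  length-φIter (suc k) = trans (length-concatMap {F = φ-block} (λ _ → length-map-upTo _ p) (φIter p k))
                               (trans (cong (_* p) (length-φIter k)) (*-comm (p ^ k) p))

  letter-digit : ∀ k i m → i < p → m < p ^ k → letter (suc k) (i + m * p) ≡ (letter k m * (h C i)) % p
  letter-digit k i m i<p m<p^k = begin
    nth (concatMap φ-block (φIter p k)) (i + m * p)
      ≡⟨ nth-concatMap (λ _ → length-map-upTo _ p) (φIter p k)
                       (subst (m <_) (sym (length-φIter k)) m<p^k) i<p ⟩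
    nth (φ-block (letter k m)) i
      ≡⟨ nth-map-upTo _ p i<p ⟩
    (letter k m * (p₂ p C i)) % p
      ≡⟨ cong (λ j → (letter k m * (j C i)) % p) p₂p≡h ⟩
    (letter k m * (h C i)) % p ∎
    where open ≡-Reasoning

  letter-zero : ∀ k → letter k 0 ≡ 1
  letter-zero zero    = refl
  letter-zero (suc k) = trans (letter-digit k 0 0 z<s (m^n>0 p k))
                              (cong (λ x → (x * (h C 0)) % p) (letter-zero k))

  -- φ_p(1) starts with 1, so the words φ_p^k(1) are prefixes of each other.
  letter-stable : ∀ k k′ {n} → n < p ^ k → n < p ^ k′ → letter k n ≡ letter k′ n
  letter-stable zero    k′       {zero}  _        _         = sym (letter-zero k′)
  letter-stable zero    k′       {suc n} (s≤s ()) _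
  letter-stable (suc k) zero     {zero}  _        _         = letter-zero (suc k)
  letter-stable (suc k) zero     {suc n} _        (s≤s ())
  letter-stable (suc k) (suc k′) {n} = quotRem-elim p
    (λ n → n < p ^ suc k → n < p ^ suc k′ → letter (suc k) n ≡ letter (suc k′) n) digit n
    where
    digit : ∀ i m → i < p → i + m * p < p ^ suc k → i + m * p < p ^ suc k′ →
      letter (suc k) (i + m * p) ≡ letter (suc k′) (i + m * p)
    digit i m i<p lt lt′ = begin
      letter (suc k) (i + m * p)
        ≡⟨ letter-digit k i m i<p (quotient-bound lt) ⟩
      (letter k m * (h C i)) % p
        ≡⟨ cong (λ x → (x * (h C i)) % p) (letter-stable k k′ (quotient-bound lt) (quotient-bound lt′)) ⟩
      (letter k′ m * (h C i)) % p
        ≡⟨ sym (letter-digit k′ i m i<p (quotient-bound lt′)) ⟩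
      letter (suc k′) (i + m * p) ∎
      where open ≡-Reasoning

  fixedPoint : Series
  fixedPoint n = letter (suc n) n

  letter≡fixedPoint : ∀ k {n} → n < p ^ k → letter k n ≡ fixedPoint n
  letter≡fixedPoint k {n} lt = letter-stable k (suc n) lt (n<p^[1+n] n)

  fixedPoint-fixed : fixedPoint ≈ binom h ⊛ dilate p fixedPoint
  fixedPoint-fixed = mk≈ (quotRem-elim p _ digit)
    where
    digit : ∀ i m → i < p → fixedPoint (i + m * p) % p ≡ (binom h ⊛ dilate p fixedPoint) (i + m * p) % p
    digit i m i<p = begin
      fixedPoint (i + m * p) % p
        ≡⟨ cong (_% p) (sym (letter≡fixedPoint (suc (suc m)) (digits-bound i<p (n<p^[1+n] m)))) ⟩
      letter (suc (suc m)) (i + m * p) % p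
        ≡⟨ cong (_% p) (letter-digit (suc m) i m i<p (n<p^[1+n] m)) ⟩
      (fixedPoint m * (h C i)) % p % p
        ≡⟨ m%n%n≡m%n (fixedPoint m * (h C i)) p ⟩
      (fixedPoint m * (h C i)) % p
        ≡⟨ cong (_% p) (*-comm (fixedPoint m) (h C i)) ⟩
      (binom h i * fixedPoint m) % p
        ≡⟨ cong (_% p) (sym (⊛-dilate-short p (binom h) fixedPoint i m i<p (binom-short h<p))) ⟩
      (binom h ⊛ dilate p fixedPoint) (i + m * p) % p ∎
      where open ≡-Reasoning

  τ-letter : ℕ → ℕ → ℕ
  τ-letter n i = if isEven i then (n * (suc (p₂ p) C ⌊ i /2⌋)) mod p else 0

  nth-τ : ∀ k {r m} → r < 2 * p → m < p ^ k →
    nth (τ p (φIter p k)) (r + m * (2 * p)) ≡ τ-letter (letter k m) r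
  nth-τ k {r} r<2p m<p^k = trans
    (nth-concatMap (λ _ → length-map-upTo _ (2 * p)) (φIter p k)
                   (subst (_ <_) (sym (length-φIter k)) m<p^k) r<2p)
    (nth-map-upTo _ (2 * p) r<2p)

  Y : Series
  Y = binom (suc h) ⊛ dilate p fixedPoint

  τ-letter-fixedPoint : ∀ {b} → b < 2 → ∀ i m → i < p →
    τ-letter (fixedPoint m) (b + i * 2) % p ≡ const (Y (i + m * p)) b % p
  τ-letter-fixedPoint {b} b<2 i m i<p =
    trans (cong₂ (λ e j → (if e then (fixedPoint m * (suc (p₂ p) C j)) mod p else 0) % p)
                 (isEven-+-*2 b i) (⌊b+i*2/2⌋≡i b i b<2))
          (byParity b b<2)
    where
    byParity : ∀ b → b < 2 →
      (if isEven b then (fixedPoint m * (suc (p₂ p) C i)) % p else 0) % p ≡ const (Y (i + m * p)) b % p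
    byParity zero _ = begin
      (fixedPoint m * (suc (p₂ p) C i)) % p % p
        ≡⟨ m%n%n≡m%n (fixedPoint m * (suc (p₂ p) C i)) p ⟩
      (fixedPoint m * (suc (p₂ p) C i)) % p
        ≡⟨ cong (λ j → (fixedPoint m * (suc j C i)) % p) p₂p≡h ⟩
      (fixedPoint m * (suc h C i)) % p
        ≡⟨ cong (_% p) (*-comm (fixedPoint m) (suc h C i)) ⟩
      (binom (suc h) i * fixedPoint m) % p
        ≡⟨ cong (_% p) (sym (⊛-dilate-short p (binom (suc h)) fixedPoint i m i<p
                               (binom-short 1+h<p))) ⟩
      Y (i + m * p) % p ∎
      where open ≡-Reasoning
    byParity (suc zero)    _ = refl
    byParity (suc (suc b)) (s≤s (s≤s ()))

  -- τ_p interleaves zeros and multiplies each letter by (1 + x)ʰ⁺¹.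
  singer≈dilate-Y : singer p ≈ dilate 2 Y
  singer≈dilate-Y = mk≈ (quotRem-elim 2 _ λ b n′ b<2 →
    quotRem-elim p (λ n′ → singer p (b + n′ * 2) % p ≡ dilate 2 Y (b + n′ * 2) % p) (digit b<2) n′)
    where
    digit : ∀ {b} → b < 2 → ∀ i m → i < p →
      singer p (b + (i + m * p) * 2) % p ≡ dilate 2 Y (b + (i + m * p) * 2) % p
    digit {b} b<2 i m i<p = begin
      nth (τ p (φIter p (suc n))) n % p
        ≡⟨ cong (λ j → nth (τ p (φIter p (suc n))) j % p) (regroup b i m p) ⟩
      nth (τ p (φIter p (suc n))) (b + i * 2 + m * (2 * p)) % p
        ≡⟨ cong (_% p) (nth-τ (suc n) r<2p m<p^[1+n]) ⟩
      τ-letter (letter (suc n) m) (b + i * 2) % p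
        ≡⟨ cong (λ x → τ-letter x (b + i * 2) % p) (letter≡fixedPoint (suc n) m<p^[1+n]) ⟩
      τ-letter (fixedPoint m) (b + i * 2) % p
        ≡⟨ τ-letter-fixedPoint b<2 i m i<p ⟩
      const (Y (i + m * p)) b % p
        ≡⟨ cong (_% p) (sym (dilate-eval 2 Y b (i + m * p) b<2)) ⟩
      dilate 2 Y n % p ∎
      where
      open ≡-Reasoning
      n : ℕ
      n = b + (i + m * p) * 2
      regroup : ∀ b i m p → b + (i + m * p) * 2 ≡ b + i * 2 + m * (2 * p)
      regroup = solve-∀
      m<p^[1+n] : m < p ^ suc n
      m<p^[1+n] = ≤-<-trans (≤-trans (m≤m*n m p) (≤-trans (m≤n+m (m * p) i)
                              (≤-trans (m≤m*n (i + m * p) 2) (m≤n+m _ b)))) (n<p^[1+n] n)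
      r<2p : b + i * 2 < 2 * p
      r<2p = <-≤-trans (+-monoˡ-< (i * 2) b<2) (≤-trans (*-monoˡ-≤ 2 i<p) (≤-reflexive (*-comm p 2)))

  singer-square : singer p ⊛ singer p ≈ dilate 2 (binom 1)
  singer-square = begin
    singer p ⊛ singer p      ≈⟨ ⊛-cong-≈ singer≈dilate-Y singer≈dilate-Y ⟩
    dilate 2 Y ⊛ dilate 2 Y  ≈⟨ ≗⇒≈ (dilate-⊛ 2 Y Y) ⟩
    dilate 2 (Y ⊛ Y)         ≈⟨ dilate-cong-≈ 2 (square-root (cong (_% p) (letter-zero 1)) fixedPoint-fixed) ⟩
    dilate 2 (binom 1)       ∎
    where open ≈-Reasoning

  Ξ-square : (singer p 0 ≡ 1) × ((n : ℕ) → ΞsqCoeff p n ≡ onePlusX² n)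
  Ξ-square = refl , λ n → begin
    ΞsqCoeff p n                 ≡⟨ cong (_% p) (sum-map-upTo (λ k → singer p k * singer p (n ∸ k)) (suc n)) ⟩
    (singer p ⊛ singer p) n % p  ≡⟨ pointwise singer-square n ⟩
    dilate 2 (binom 1) n % p     ≡⟨ cong (_% p) (dilate-2-binom-1 n) ⟩
    onePlusX² n % p              ≡⟨ m<n⇒m%n≡m (≤-<-trans (onePlusX²≤1 n) 1<p) ⟩
    onePlusX² n                  ∎
    where
    open ≡-Reasoning
    onePlusX²≤1 : ∀ n → onePlusX² n ≤ 1
    onePlusX²≤1 zero                = ≤-refl
    onePlusX²≤1 (suc zero)          = z≤n
    onePlusX²≤1 (suc (suc zero))    = ≤-refl
    onePlusX²≤1 (suc (suc (suc n))) = z≤n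

odd>1⇒1+2[1+h] : ∀ {p} → 1 < p → ¬ (2 ∣ p) → Σ ℕ λ h′ → suc (2 * suc h′) ≡ p
odd>1⇒1+2[1+h] {p} 1<p p-odd = split (p % 2) (p / 2) (m%n<n p 2) (m≡m%n+[m/n]*n p 2)
  where
  split : ∀ r d → r < 2 → p ≡ r + d * 2 → Σ ℕ λ h′ → suc (2 * suc h′) ≡ p
  split zero          d       _ p≡2d   = ⊥-elim (p-odd (divides d p≡2d))
  split (suc zero)    zero    _ refl   = ⊥-elim (<-irrefl refl 1<p)
  split (suc zero)    (suc d) _ p≡2d+1 = d , sym (trans p≡2d+1 (cong suc (*-comm (suc d) 2)))
  split (suc (suc r)) _       (s≤s (s≤s ())) _

lemma3p13 : (p : ℕ) → Prime p → ¬ (2 ∣ p) →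
    (singer p 0 ≡ 1) × ((n : ℕ) → ΞsqCoeff p n ≡ onePlusX² n)
lemma3p13 p p-prime p-odd with odd>1⇒1+2[1+h] (nonTrivial⇒n>1 p {{prime⇒nonTrivial p-prime}}) p-odd
... | h′ , refl = SingerSequence.Ξ-square h′ p-prime
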